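{- For all integers $n,p,m\ge 0$ (and $k\ge1$), the numbers $H_{n,p}(m)$ defined below satisfy \[ H_{n+1,p}(m)=\frac{l\,(p+1)\,(p+a+m)^{k}}{(p+a+m+1)^{k}}\,H_{n,p+1}(m)-pq\,H_{n,p}(m), \] and $H_{0,p}(m)=\dfrac{l^{a}}{a^{k}}$ for all $p\ge 0$.
   Context: Let $k\ge1$ be an integer, let $a,q,l_1,\dots,l_k$ be nonzero reals, $L=(l_1,\dots,l_k)$, $l=\prod_{i=1}^k l_i$; denominators $a+j$ ($j\ge0$ integer) are assumed nonzero and $l^{a+i}$ means $l^a l^i$. Let $s(n,i)$ be the signed Stirling numbers of the first kind ($\frac{1}{i!}(\ln(1+x))^i=\sum_{n\ge i}s(n,i)\frac{x^n}{n!}$) and $\left\{ {n \atop i} \right\}$ the Stirling numbers of the second kind. For integers $n,m\ge0$ define the generalized $m$-poly-Bernoulli numbers \[ \mathcal{B}_{n,m}^{(k)}(a,q,L)=\frac{(a+m)^k}{a^k}\sum_{i=0}^{n}\frac{i!\,(-q)^{n-i}\,l^{i+a}}{(a+m+i)^k}\left\{ {n \atop i} \right\}, \] and for integers $n,p,m\ge0$ \[ H_{n,p}(m)=\frac{1}{p!\,l^{p}}\Big(\frac{p+a+m}{a+m}\Big)^{k}\sum_{i=0}^{p}s(p,i)(-q)^{p-i}\mathcal{B}_{n+i,m}^{(k)}(a,q,L). \] -}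

module Defs where

open import Level using (Level; _⊔_) renaming (suc to lsuc)
open import Data.Nat as ℕ using (ℕ; zero; suc; _∸_)
open import Data.Nat.Base using () renaming (_! to _!ℕ)
open import Data.Integer as ℤ using (ℤ; +_; -[1+_])
open import Data.Fin using (Fin)
open import Relation.Nullary using (¬_)
open import Algebra.Bundles using (CommutativeRing)

stirling₂ : ℕ → ℕ → ℕ
stirling₂ zero    zero    = 1
stirling₂ zero    (suc i) = 0
stirling₂ (suc n) zero    = 0
stirling₂ (suc n) (suc i) = suc i ℕ.* stirling₂ n (suc i) ℕ.+ stirling₂ n i

-- signed Stirling numbers of the first kind  s(n,i)
-- ( (1/i!) (ln(1+x))^i = Σ_n s(n,i) x^n/n! ),  s(n+1,i+1) = s(n,i) - n s(n,i+1)
stirling₁ : ℕ → ℕ → ℤ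
stirling₁ zero    zero    = + 1
stirling₁ zero    (suc i) = + 0
stirling₁ (suc n) zero    = + 0
stirling₁ (suc n) (suc i) = stirling₁ n i ℤ.- (+ n) ℤ.* stirling₁ n (suc i)

-- A field: commutative ring with 0 ≠ 1 and a (total) inverse function
-- which is a genuine inverse on nonzero elements (the value at 0 is
-- irrelevant; x / y := x * y ⁻¹).

record Field (c ℓ : Level) : Set (lsuc (c ⊔ ℓ)) where
  field
    commutativeRing : CommutativeRing c ℓ
  open CommutativeRing commutativeRing public
  infix 9 _⁻¹
  field
    _⁻¹      : Carrier → Carrier
    ⁻¹-cong  : ∀ {x y} → x ≈ y → x ⁻¹ ≈ y ⁻¹
    ⁻¹-inverse : ∀ x → ¬ (x ≈ 0#) → x * x ⁻¹ ≈ 1#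
    0≉1      : ¬ (0# ≈ 1#)

  infixl 7 _/_
  _/_ : Carrier → Carrier → Carrier
  x / y = x * y ⁻¹

  fromℕ : ℕ → Carrier
  fromℕ zero    = 0#
  fromℕ (suc n) = 1# + fromℕ n

  fromℤ : ℤ → Carrier
  fromℤ (+ n)     = fromℕ n
  fromℤ -[1+ n ]  = - fromℕ (suc n)

  infixr 8 _^_
  _^_ : Carrier → ℕ → Carrier
  x ^ zero  = 1#
  x ^ suc n = x * x ^ n

  sumTo : ℕ → (ℕ → Carrier) → Carrier
  sumTo zero    f = f 0
  sumTo (suc n) f = sumTo n f + f (suc n)

  prod : (k : ℕ) → (Fin k → Carrier) → Carrier
  prod zero    L = 1#
  prod (suc k) L = L Fin.zero * prod k (λ i → L (Fin.suc i))
    where import Data.Fin as Fin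

  CharZero : Set ℓ
  CharZero = ∀ n → ¬ (fromℕ (suc n) ≈ 0#)

-- The generalized m-poly-Bernoulli numbers and H_{n,p}(m).
-- Parameters: k, a, q, L = (l_1..l_k), and la standing for l^a
-- (so l^{a+i} = la * l^i).

module PolyBernoulli {c ℓ} (F : Field c ℓ)
                     (k : ℕ) (a q la : Field.Carrier F)
                     (L : Fin k → Field.Carrier F) where
  open Field F

  l : Carrier
  l = prod k L

  B : ℕ → ℕ → Carrier
  B n m = ((a + fromℕ m) ^ k / a ^ k)
        * sumTo n (λ i → fromℕ (i !ℕ) * (- q) ^ (n ∸ i) * (la * l ^ i)
                          / (a + fromℕ m + fromℕ i) ^ k
                          * fromℕ (stirling₂ n i))

  H : ℕ → ℕ → ℕ → Carrier
  H n p m = (fromℕ (p !ℕ) * l ^ p) ⁻¹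
          * ((fromℕ p + a + fromℕ m) / (a + fromℕ m)) ^ k
          * sumTo p (λ i → fromℤ (stirling₁ p i) * (- q) ^ (p ∸ i) * B (n ℕ.+ i) m)

-- Write H_{n,p}(m) = A_p · T_p(b) with A_p = ((p+a+m)/(a+m))^k / (p! l^p) and the Stirling
-- transform T_p(b) = Σ_i s(p,i) (-q)^{p-i} b_i of b_i = B_{n+i,m}.  The recurrence
-- s(p+1,i+1) = s(p,i) - p s(p,i+1) gives T_{p+1}(b) = T_p(b ∘ suc) + pq T_p(b), and
-- A_p = l (p+1) (p+a+m)^k / (p+a+m+1)^k · A_{p+1}; together these are the recurrence for H.
-- For n = 0, B_{j,m} = (a+m)^k/a^k · Σ_i w_i S(j,i) (-q)^{j-i} with w_i = i! l^{a+i} / (a+m+i)^k,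
-- and T_p inverts this: Σ_j s(p,j) x^{p-j} S(j,i) x^{j-i} = δ_{p,i}, again by the recurrence
-- for T.  Hence H_{0,p}(m) = A_p (a+m)^k/a^k · w_p = l^a/a^k.

module Submission where

open import Defs
open import Data.Nat as ℕ using (ℕ; zero; suc; NonZero; _∸_; _≤_; _<_; _≤′_; ≤′-refl; ≤′-step; s≤s)
open import Data.Nat.Base using (_!)
import Data.Nat.Properties as ℕP
open import Data.Integer as ℤ using (+_; -[1+_]; _⊖_)
import Data.Integer.Properties as ℤP
open import Data.Fin as Fin using (Fin)
open import Data.Maybe using (Maybe; just; nothing)
open import Data.Product using (_×_; _,_)
open import Relation.Nullary using (¬_; yes; no)
open import Relation.Binary.PropositionalEquality as ≡ using (_≡_)
open import Algebra.Bundles using (CommutativeRing)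
import Algebra.Solver.Ring.AlmostCommutativeRing as ACR

stirling₁-vanishes : ∀ {p i} → p < i → stirling₁ p i ≡ + 0
stirling₁-vanishes {zero}  {suc i} _ = ≡.refl
stirling₁-vanishes {suc p} {suc i} (s≤s p<i)
  rewrite stirling₁-vanishes p<i | stirling₁-vanishes (ℕP.m≤n⇒m≤1+n p<i) | ℤP.*-zeroʳ (+ p) = ≡.refl

stirling₂-vanishes : ∀ {n i} → n < i → stirling₂ n i ≡ 0
stirling₂-vanishes {zero}  {suc i} _ = ≡.refl
stirling₂-vanishes {suc n} {suc i} (s≤s n<i)
  rewrite stirling₂-vanishes (ℕP.m≤n⇒m≤1+n n<i) | stirling₂-vanishes n<i | ℕP.*-zeroʳ i = ≡.refl

module _ {r ℓ} (F : Field r ℓ) where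
  open Field F
  open import Algebra.Properties.Ring ring using (-‿distribʳ-*; -‿distribˡ-*; -‿involutive; -0#≈0#; -‿+-comm)
  open import Algebra.Properties.CommutativeSemigroup +-commutativeSemigroup using (interchange)
  import Algebra.Properties.Semiring.Mult semiring as Mult
  import Algebra.Properties.CommutativeSemiring.Exp commutativeSemiring as Exp
  open import Relation.Binary.Reasoning.Setoid setoid

  fromℕ≡×1# : ∀ n → fromℕ n ≡ n Mult.× 1#
  fromℕ≡×1# zero    = ≡.refl
  fromℕ≡×1# (suc n) = ≡.cong (_+_ 1#) (fromℕ≡×1# n)

  fromℕ-homo-+ : ∀ m n → fromℕ (m ℕ.+ n) ≈ fromℕ m + fromℕ n
  fromℕ-homo-+ m n rewrite fromℕ≡×1# (m ℕ.+ n) | fromℕ≡×1# m | fromℕ≡×1# n = Mult.×-homo-+ 1# m n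

  fromℕ-homo-* : ∀ m n → fromℕ (m ℕ.* n) ≈ fromℕ m * fromℕ n
  fromℕ-homo-* m n rewrite fromℕ≡×1# (m ℕ.* n) | fromℕ≡×1# m | fromℕ≡×1# n = Mult.×1-homo-* m n

  ^≡^ : ∀ x n → x ^ n ≡ x Exp.^ n
  ^≡^ x zero    = ≡.refl
  ^≡^ x (suc n) = ≡.cong (x *_) (^≡^ x n)

  ^-congˡ : ∀ n {x y} → x ≈ y → x ^ n ≈ y ^ n
  ^-congˡ n {x} {y} x≈y rewrite ^≡^ x n | ^≡^ y n = Exp.^-congˡ n x≈y

  ^-distrib-* : ∀ x y n → (x * y) ^ n ≈ x ^ n * y ^ n
  ^-distrib-* x y n rewrite ^≡^ (x * y) n | ^≡^ x n | ^≡^ y n = Exp.^-distrib-* x y n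

  fromℤ-homo-neg : ∀ i → fromℤ (ℤ.- i) ≈ - fromℤ i
  fromℤ-homo-neg (+ zero)  = sym -0#≈0#
  fromℤ-homo-neg (+ suc n) = refl
  fromℤ-homo-neg -[1+ n ]  = sym (-‿involutive _)

  fromℤ-⊖ : ∀ m n → fromℤ (m ⊖ n) ≈ fromℕ m - fromℕ n
  fromℤ-⊖ m zero = begin
    fromℤ (m ⊖ 0)   ≡⟨ ≡.cong fromℤ (ℤP.⊖-≥ {m} ℕ.z≤n) ⟩
    fromℕ m         ≈⟨ sym (+-identityʳ _) ⟩
    fromℕ m + 0#    ≈⟨ +-congˡ (sym -0#≈0#) ⟩
    fromℕ m - 0#    ∎
  fromℤ-⊖ zero (suc n) = sym (+-identityˡ _)
  fromℤ-⊖ (suc m) (suc n) = begin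
    fromℤ (suc m ⊖ suc n)                    ≡⟨ ≡.cong fromℤ (ℤP.[1+m]⊖[1+n]≡m⊖n m n) ⟩
    fromℤ (m ⊖ n)                            ≈⟨ fromℤ-⊖ m n ⟩
    fromℕ m - fromℕ n                        ≈⟨ sym (+-identityˡ _) ⟩
    0# + (fromℕ m - fromℕ n)                 ≈⟨ +-congʳ (sym (-‿inverseʳ 1#)) ⟩
    (1# - 1#) + (fromℕ m - fromℕ n)          ≈⟨ interchange _ _ _ _ ⟩
    (1# + fromℕ m) + (- 1# - fromℕ n)        ≈⟨ +-congˡ (-‿+-comm _ _) ⟩
    (1# + fromℕ m) - (1# + fromℕ n)          ∎

  fromℤ-homo-+ : ∀ i j → fromℤ (i ℤ.+ j) ≈ fromℤ i + fromℤ j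
  fromℤ-homo-+ (+ m)    (+ n)    = fromℕ-homo-+ m n
  fromℤ-homo-+ (+ m)    -[1+ n ] = fromℤ-⊖ m (suc n)
  fromℤ-homo-+ -[1+ m ] (+ n)    = trans (fromℤ-⊖ n (suc m)) (+-comm _ _)
  fromℤ-homo-+ -[1+ m ] -[1+ n ] = begin
    - fromℕ (suc (suc (m ℕ.+ n)))       ≡⟨ ≡.cong (λ t → - fromℕ (suc t)) (≡.sym (ℕP.+-suc m n)) ⟩
    - fromℕ (suc m ℕ.+ suc n)           ≈⟨ -‿cong (fromℕ-homo-+ (suc m) (suc n)) ⟩
    - (fromℕ (suc m) + fromℕ (suc n))   ≈⟨ sym (-‿+-comm _ _) ⟩
    - fromℕ (suc m) - fromℕ (suc n)     ∎

  fromℤ-homo-pos-* : ∀ m j → fromℤ (+ m ℤ.* j) ≈ fromℕ m * fromℤ j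
  fromℤ-homo-pos-* m (+ n) = trans (reflexive (≡.cong fromℤ (≡.sym (ℤP.pos-* m n)))) (fromℕ-homo-* m n)
  fromℤ-homo-pos-* m -[1+ n ] = begin
    fromℤ (+ m ℤ.* ℤ.- + suc n)     ≡⟨ ≡.cong fromℤ (≡.sym (ℤP.neg-distribʳ-* (+ m) (+ suc n))) ⟩
    fromℤ (ℤ.- (+ m ℤ.* + suc n))   ≈⟨ fromℤ-homo-neg (+ m ℤ.* + suc n) ⟩
    - fromℤ (+ m ℤ.* + suc n)       ≈⟨ -‿cong (fromℤ-homo-pos-* m (+ suc n)) ⟩
    - (fromℕ m * fromℕ (suc n))     ≈⟨ -‿distribʳ-* _ _ ⟩
    fromℕ m * - fromℕ (suc n)       ∎

  fromℤ-homo-* : ∀ i j → fromℤ (i ℤ.* j) ≈ fromℤ i * fromℤ j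
  fromℤ-homo-* (+ m) j = fromℤ-homo-pos-* m j
  fromℤ-homo-* -[1+ m ] j = begin
    fromℤ (ℤ.- + suc m ℤ.* j)       ≡⟨ ≡.cong fromℤ (≡.sym (ℤP.neg-distribˡ-* (+ suc m) j)) ⟩
    fromℤ (ℤ.- (+ suc m ℤ.* j))     ≈⟨ fromℤ-homo-neg (+ suc m ℤ.* j) ⟩
    - fromℤ (+ suc m ℤ.* j)         ≈⟨ -‿cong (fromℤ-homo-pos-* (suc m) j) ⟩
    - (fromℕ (suc m) * fromℤ j)     ≈⟨ -‿distribˡ-* _ _ ⟩
    - fromℕ (suc m) * fromℤ j       ∎

  fromℤ-morphism : CommutativeRing.rawRing ℤP.+-*-commutativeRing
                     ACR.-Raw-AlmostCommutative⟶ ACR.fromCommutativeRing commutativeRing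
  fromℤ-morphism = record
    { ⟦_⟧    = fromℤ
    ; +-homo = fromℤ-homo-+
    ; *-homo = fromℤ-homo-*
    ; -‿homo = fromℤ-homo-neg
    ; 0-homo = refl
    ; 1-homo = +-identityʳ 1#
    }

  fromℤ-≡? : ∀ i j → Maybe (fromℤ i ≈ fromℤ j)
  fromℤ-≡? i j with i ℤ.≟ j
  ... | yes ≡.refl = just refl
  ... | no _       = nothing

  open import Algebra.Solver.Ring _ _ fromℤ-morphism fromℤ-≡?

  ≉0-resp-≈ : ∀ {x y} → x ≈ y → ¬ x ≈ 0# → ¬ y ≈ 0#
  ≉0-resp-≈ x≈y x≉0 y≈0 = x≉0 (trans x≈y y≈0)

  ⁻¹-inverseˡ : ∀ {x} → ¬ x ≈ 0# → x ⁻¹ * x ≈ 1#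
  ⁻¹-inverseˡ {x} x≉0 = trans (*-comm _ _) (⁻¹-inverse x x≉0)

  *-≉0 : ∀ {x y} → ¬ x ≈ 0# → ¬ y ≈ 0# → ¬ x * y ≈ 0#
  *-≉0 {x} {y} x≉0 y≉0 xy≈0 = y≉0 (begin
    y                ≈⟨ sym (*-identityˡ y) ⟩
    1# * y           ≈⟨ *-congʳ (sym (⁻¹-inverseˡ x≉0)) ⟩
    x ⁻¹ * x * y     ≈⟨ *-assoc _ _ _ ⟩
    x ⁻¹ * (x * y)   ≈⟨ *-congˡ xy≈0 ⟩
    x ⁻¹ * 0#        ≈⟨ zeroʳ _ ⟩
    0#               ∎)

  ^-≉0 : ∀ {x} n → ¬ x ≈ 0# → ¬ x ^ n ≈ 0#
  ^-≉0 zero    _   1≈0 = 0≉1 (sym 1≈0)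
  ^-≉0 (suc n) x≉0 = *-≉0 x≉0 (^-≉0 n x≉0)

  prod-≉0 : ∀ k (L : Fin k → Carrier) → (∀ i → ¬ L i ≈ 0#) → ¬ prod k L ≈ 0#
  prod-≉0 zero    L L≉0 1≈0 = 0≉1 (sym 1≈0)
  prod-≉0 (suc k) L L≉0 = *-≉0 (L≉0 Fin.zero) (prod-≉0 k (λ i → L (Fin.suc i)) (λ i → L≉0 (Fin.suc i)))

  fromℕ-!-≉0 : CharZero → ∀ n → ¬ fromℕ (n !) ≈ 0#
  fromℕ-!-≉0 char0 zero    = char0 0
  fromℕ-!-≉0 char0 (suc n) =
    ≉0-resp-≈ (sym (fromℕ-homo-* (suc n) (n !))) (*-≉0 (char0 n) (fromℕ-!-≉0 char0 n))

  ⁻¹-unique : ∀ {x y} → ¬ x ≈ 0# → x * y ≈ 1# → y ≈ x ⁻¹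
  ⁻¹-unique {x} {y} x≉0 xy≈1 = begin
    y                ≈⟨ sym (*-identityʳ y) ⟩
    y * 1#           ≈⟨ *-congˡ (sym (⁻¹-inverse x x≉0)) ⟩
    y * (x * x ⁻¹)   ≈⟨ solve 3 (λ x y x' → y :* (x :* x') := x :* y :* x') refl x y (x ⁻¹) ⟩
    x * y * x ⁻¹     ≈⟨ *-congʳ xy≈1 ⟩
    1# * x ⁻¹        ≈⟨ *-identityˡ _ ⟩
    x ⁻¹             ∎

  ⁻¹-distrib-* : ∀ {x y} → ¬ x ≈ 0# → ¬ y ≈ 0# → (x * y) ⁻¹ ≈ x ⁻¹ * y ⁻¹
  ⁻¹-distrib-* {x} {y} x≉0 y≉0 = sym (⁻¹-unique (*-≉0 x≉0 y≉0) (begin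
    x * y * (x ⁻¹ * y ⁻¹)
      ≈⟨ solve 4 (λ x y x' y' → x :* y :* (x' :* y') := x :* x' :* (y :* y')) refl x y (x ⁻¹) (y ⁻¹) ⟩
    x * x ⁻¹ * (y * y ⁻¹)   ≈⟨ *-cong (⁻¹-inverse x x≉0) (⁻¹-inverse y y≉0) ⟩
    1# * 1#                 ≈⟨ *-identityˡ 1# ⟩
    1#                      ∎))

  /-*-cancel : ∀ x {y} → ¬ y ≈ 0# → x / y * y ≈ x
  /-*-cancel x {y} y≉0 = begin
    x * y ⁻¹ * y     ≈⟨ *-assoc _ _ _ ⟩
    x * (y ⁻¹ * y)   ≈⟨ *-congˡ (⁻¹-inverseˡ y≉0) ⟩
    x * 1#           ≈⟨ *-identityʳ x ⟩
    x                ∎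

  sumTo-cong : ∀ n {f g : ℕ → Carrier} → (∀ i → i ≤ n → f i ≈ g i) → sumTo n f ≈ sumTo n g
  sumTo-cong zero    f≈g = f≈g 0 ℕ.z≤n
  sumTo-cong (suc n) f≈g =
    +-cong (sumTo-cong n (λ i i≤n → f≈g i (ℕP.m≤n⇒m≤1+n i≤n))) (f≈g (suc n) ℕP.≤-refl)

  sumTo-+ : ∀ n (f g : ℕ → Carrier) → sumTo n (λ i → f i + g i) ≈ sumTo n f + sumTo n g
  sumTo-+ zero    f g = refl
  sumTo-+ (suc n) f g = trans (+-congʳ (sumTo-+ n f g)) (interchange _ _ _ _)

  *-distribˡ-sumTo : ∀ n x (f : ℕ → Carrier) → x * sumTo n f ≈ sumTo n (λ i → x * f i)
  *-distribˡ-sumTo zero    x f = refl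
  *-distribˡ-sumTo (suc n) x f = trans (distribˡ _ _ _) (+-congʳ (*-distribˡ-sumTo n x f))

  sumTo-suc : ∀ n (f : ℕ → Carrier) → sumTo (suc n) f ≈ f 0 + sumTo n (λ i → f (suc i))
  sumTo-suc zero    f = refl
  sumTo-suc (suc n) f = trans (+-congʳ (sumTo-suc n f)) (+-assoc _ _ _)

  sumTo-comm : ∀ m n (h : ℕ → ℕ → Carrier) →
               sumTo m (λ i → sumTo n (h i)) ≈ sumTo n (λ j → sumTo m (λ i → h i j))
  sumTo-comm zero    n h = refl
  sumTo-comm (suc m) n h =
    trans (+-congʳ (sumTo-comm m n h)) (sym (sumTo-+ n (λ j → sumTo m (λ i → h i j)) (h (suc m))))

  sumTo-truncate : ∀ {m n} (f : ℕ → Carrier) → m ≤ n → (∀ i → m < i → f i ≈ 0#) → sumTo n f ≈ sumTo m f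
  sumTo-truncate {m} f m≤n f≈0 = go (ℕP.≤⇒≤′ m≤n)
    where
    go : ∀ {n} → m ≤′ n → sumTo n f ≈ sumTo m f
    go ≤′-refl         = refl
    go (≤′-step m≤′n) = trans (+-cong (go m≤′n) (f≈0 _ (s≤s (ℕP.≤′⇒≤ m≤′n)))) (+-identityʳ _)

  δ : ℕ → ℕ → Carrier
  δ zero    zero    = 1#
  δ zero    (suc i) = 0#
  δ (suc p) zero    = 0#
  δ (suc p) (suc i) = δ p i

  δ-scale : ∀ p i y → fromℕ i * y * δ p i ≈ fromℕ p * y * δ p i
  δ-scale zero    zero    y = refl
  δ-scale zero    (suc i) y = trans (zeroʳ _) (sym (zeroʳ _))
  δ-scale (suc p) zero    y = trans (zeroʳ _) (sym (zeroʳ _))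
  δ-scale (suc p) (suc i) y = begin
    (1# + fromℕ i) * y * δ p i               ≈⟨ trans (*-congʳ (distribʳ _ _ _)) (distribʳ _ _ _) ⟩
    1# * y * δ p i + fromℕ i * y * δ p i     ≈⟨ +-congˡ (δ-scale p i y) ⟩
    1# * y * δ p i + fromℕ p * y * δ p i     ≈⟨ trans (sym (distribʳ _ _ _)) (*-congʳ (sym (distribʳ _ _ _))) ⟩
    (1# + fromℕ p) * y * δ p i               ∎

  δ-sift : ∀ p (w : ℕ → Carrier) → sumTo p (λ i → w i * δ p i) ≈ w p
  δ-sift zero    w = *-identityʳ _
  δ-sift (suc p) w = begin
    sumTo (suc p) (λ i → w i * δ (suc p) i)       ≈⟨ sumTo-suc p _ ⟩
    w 0 * 0# + sumTo p (λ i → w (suc i) * δ p i)  ≈⟨ +-cong (zeroʳ _) (δ-sift p (λ i → w (suc i))) ⟩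
    0# + w (suc p)                                ≈⟨ +-identityˡ _ ⟩
    w (suc p)                                     ∎

  fromℤ-stirling₁-vanishes : ∀ {p i} → p < i → fromℤ (stirling₁ p i) ≈ 0#
  fromℤ-stirling₁-vanishes p<i = reflexive (≡.cong fromℤ (stirling₁-vanishes p<i))

  fromℕ-stirling₂-vanishes : ∀ {n i} → n < i → fromℕ (stirling₂ n i) ≈ 0#
  fromℕ-stirling₂-vanishes n<i = reflexive (≡.cong fromℕ (stirling₂-vanishes n<i))

  fromℤ-stirling₁-suc : ∀ p i → fromℤ (stirling₁ (suc p) (suc i)) ≈
                        fromℤ (stirling₁ p i) - fromℕ p * fromℤ (stirling₁ p (suc i))
  fromℤ-stirling₁-suc p i = trans (fromℤ-homo-+ (stirling₁ p i) _)
    (+-congˡ (trans (fromℤ-homo-neg (+ p ℤ.* stirling₁ p (suc i))) (-‿cong (fromℤ-homo-* (+ p) _))))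

  fromℕ-stirling₂-suc : ∀ j i → fromℕ (stirling₂ (suc j) (suc i)) ≈
                        fromℕ (suc i) * fromℕ (stirling₂ j (suc i)) + fromℕ (stirling₂ j i)
  fromℕ-stirling₂-suc j i = trans (fromℕ-homo-+ (suc i ℕ.* stirling₂ j (suc i)) _) (+-congʳ (fromℕ-homo-* (suc i) (stirling₂ j (suc i))))

  fromℕ-*-stirling₁-zero : ∀ p → fromℕ p * fromℤ (stirling₁ p 0) ≈ 0#
  fromℕ-*-stirling₁-zero zero    = zeroˡ _
  fromℕ-*-stirling₁-zero (suc p) = zeroʳ _

  -- For j ≤ i both truncated exponents are 0, so y has to vanish.
  *-^-∸-suc : ∀ x {y} j i → (j ≤ i → y ≈ 0#) → y * x ^ (j ∸ i) ≈ x * (y * x ^ (j ∸ suc i))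
  *-^-∸-suc x {y} j i y≈0 with i ℕ.<? j
  ... | yes i<j rewrite ℕP.+-∸-assoc 1 i<j =
    solve 3 (λ x y z → y :* (x :* z) := x :* (y :* z)) refl x y _
  ... | no i≮j = trans (*-congʳ y≈0′) (trans (zeroˡ _)
                   (sym (trans (*-congˡ (trans (*-congʳ y≈0′) (zeroˡ _))) (zeroʳ x))))
    where
    y≈0′ : y ≈ 0#
    y≈0′ = y≈0 (ℕP.≮⇒≥ i≮j)

  module _ (x : Carrier) where

    stirlingTransform : ℕ → (ℕ → Carrier) → Carrier
    stirlingTransform p b = sumTo p (λ i → fromℤ (stirling₁ p i) * x ^ (p ∸ i) * b i)

    stirlingTransform-cong : ∀ p {b b′ : ℕ → Carrier} → (∀ i → i ≤ p → b i ≈ b′ i) →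
                             stirlingTransform p b ≈ stirlingTransform p b′
    stirlingTransform-cong p b≈b′ = sumTo-cong p (λ i i≤p → *-congˡ (b≈b′ i i≤p))

    stirlingTransform-+ : ∀ p (b b′ : ℕ → Carrier) →
      stirlingTransform p (λ i → b i + b′ i) ≈ stirlingTransform p b + stirlingTransform p b′
    stirlingTransform-+ p b b′ = trans (sumTo-cong p (λ i _ → distribˡ _ _ _)) (sumTo-+ p _ _)

    stirlingTransform-*ˡ : ∀ p y (b : ℕ → Carrier) →
      stirlingTransform p (λ i → y * b i) ≈ y * stirlingTransform p b
    stirlingTransform-*ˡ p y b = trans
      (sumTo-cong p (λ i _ → solve 3 (λ s y b → s :* (y :* b) := y :* (s :* b)) refl _ y (b i)))
      (sym (*-distribˡ-sumTo p y _))

    stirlingTransform-sumTo : ∀ p n (h : ℕ → ℕ → Carrier) →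
      stirlingTransform p (λ j → sumTo n (h j)) ≈ sumTo n (λ i → stirlingTransform p (λ j → h j i))
    stirlingTransform-sumTo p n h =
      trans (sumTo-cong p (λ j _ → *-distribˡ-sumTo n _ (h j))) (sumTo-comm p n _)

    stirling₁-suc-summand : ∀ p i y → fromℤ (stirling₁ (suc p) (suc i)) * x ^ (p ∸ i) * y ≈
      fromℤ (stirling₁ p i) * x ^ (p ∸ i) * y + - (fromℕ p * x) * (fromℤ (stirling₁ p (suc i)) * x ^ (p ∸ suc i) * y)
    stirling₁-suc-summand p i y = begin
      fromℤ (stirling₁ (suc p) (suc i)) * x ^ (p ∸ i) * y
        ≈⟨ *-congʳ (*-congʳ (fromℤ-stirling₁-suc p i)) ⟩
      (σ - fromℕ p * σ′) * x ^ (p ∸ i) * y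
        ≈⟨ solve 5 (λ s P s′ X y → (s :- P :* s′) :* X :* y := s :* X :* y :+ :- P :* (s′ :* X) :* y)
                   refl σ (fromℕ p) σ′ _ y ⟩
      σ * x ^ (p ∸ i) * y + - fromℕ p * (σ′ * x ^ (p ∸ i)) * y
        ≈⟨ +-congˡ (*-congʳ (*-congˡ (*-^-∸-suc x p i (λ p≤i → fromℤ-stirling₁-vanishes (s≤s p≤i))))) ⟩
      σ * x ^ (p ∸ i) * y + - fromℕ p * (x * (σ′ * x ^ (p ∸ suc i))) * y
        ≈⟨ solve 5 (λ u P x s y → u :+ :- P :* (x :* s) :* y := u :+ :- (P :* x) :* (s :* y))
                   refl (σ * x ^ (p ∸ i) * y) (fromℕ p) x _ y ⟩
      σ * x ^ (p ∸ i) * y + - (fromℕ p * x) * (σ′ * x ^ (p ∸ suc i) * y) ∎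
      where
      σ σ′ : Carrier
      σ = fromℤ (stirling₁ p i)
      σ′ = fromℤ (stirling₁ p (suc i))

    stirlingTransform-suc : ∀ p (b : ℕ → Carrier) → stirlingTransform (suc p) b ≈
      stirlingTransform p (λ i → b (suc i)) - fromℕ p * x * stirlingTransform p b
    stirlingTransform-suc p b = begin
      stirlingTransform (suc p) b
        ≈⟨ sumTo-suc p _ ⟩
      0# * x ^ suc p * b 0 + sumTo p (λ i → fromℤ (stirling₁ (suc p) (suc i)) * x ^ (p ∸ i) * b (suc i))
        ≈⟨ +-cong (trans (*-congʳ (zeroˡ _)) (zeroˡ _)) (sumTo-cong p (λ i _ → stirling₁-suc-summand p i (b (suc i)))) ⟩
      0# + sumTo p (λ i → fromℤ (stirling₁ p i) * x ^ (p ∸ i) * b (suc i) + - (fromℕ p * x) * t (suc i))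
        ≈⟨ trans (+-identityˡ _) (trans (sumTo-+ p _ _) (+-congˡ (sym (*-distribˡ-sumTo p _ _)))) ⟩
      T′ + - (fromℕ p * x) * sumTo p (λ i → t (suc i))
        ≈⟨ solve 5 (λ T′ P x t₀ S → T′ :+ :- (P :* x) :* S := T′ :- P :* x :* (t₀ :+ S) :+ x :* (P :* t₀))
                   refl T′ (fromℕ p) x (t 0) _ ⟩
      T′ - fromℕ p * x * (t 0 + sumTo p (λ i → t (suc i))) + x * (fromℕ p * t 0)
        ≈⟨ +-cong (+-congˡ (-‿cong (*-congˡ t-sum))) (trans (*-congˡ p*t₀≈0) (zeroʳ x)) ⟩
      T′ - fromℕ p * x * stirlingTransform p b + 0#
        ≈⟨ +-identityʳ _ ⟩
      T′ - fromℕ p * x * stirlingTransform p b ∎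
      where
      t : ℕ → Carrier
      t i = fromℤ (stirling₁ p i) * x ^ (p ∸ i) * b i
      T′ : Carrier
      T′ = stirlingTransform p (λ i → b (suc i))

      t-sum : t 0 + sumTo p (λ i → t (suc i)) ≈ stirlingTransform p b
      t-sum = trans (sym (sumTo-suc p t))
        (sumTo-truncate t (ℕP.n≤1+n p) (λ i p<i →
          trans (*-congʳ (*-congʳ (fromℤ-stirling₁-vanishes p<i))) (trans (*-congʳ (zeroˡ _)) (zeroˡ _))))

      p*t₀≈0 : fromℕ p * t 0 ≈ 0#
      p*t₀≈0 = begin
        fromℕ p * (fromℤ (stirling₁ p 0) * x ^ p * b 0)
          ≈⟨ solve 4 (λ P s X b → P :* (s :* X :* b) := P :* s :* (X :* b)) refl _ _ _ _ ⟩
        fromℕ p * fromℤ (stirling₁ p 0) * (x ^ p * b 0)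
          ≈⟨ trans (*-congʳ (fromℕ-*-stirling₁-zero p)) (zeroˡ _) ⟩
        0# ∎

    stirling-orthogonality : ∀ p i →
      stirlingTransform p (λ j → fromℕ (stirling₂ j i) * x ^ (j ∸ i)) ≈ δ p i
    stirling-orthogonality zero zero = trans (*-cong 1*1≈1 1*1≈1) (*-identityˡ 1#)
      where
      1*1≈1 : fromℕ 1 * 1# ≈ 1#
      1*1≈1 = trans (*-identityʳ (fromℕ 1)) (+-identityʳ 1#)
    stirling-orthogonality zero (suc i) = trans (*-congˡ (zeroˡ 1#)) (zeroʳ _)
    stirling-orthogonality (suc p) zero = begin
      stirlingTransform (suc p) b₀
        ≈⟨ stirlingTransform-suc p b₀ ⟩
      stirlingTransform p (λ j → 0# * x ^ suc j) - fromℕ p * x * stirlingTransform p b₀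
        ≈⟨ +-cong (stirlingTransform-*ˡ p 0# _) (-‿cong (*-congˡ (stirling-orthogonality p 0))) ⟩
      0# * stirlingTransform p (λ j → x ^ suc j) - fromℕ p * x * δ p 0
        ≈⟨ +-congˡ (-‿cong (sym (δ-scale p 0 x))) ⟩
      0# * stirlingTransform p (λ j → x ^ suc j) - 0# * x * δ p 0
        ≈⟨ solve 3 (λ t x d → con (+ 0) :* t :- con (+ 0) :* x :* d := con (+ 0)) refl _ x _ ⟩
      0# ∎
      where
      b₀ : ℕ → Carrier
      b₀ j = fromℕ (stirling₂ j 0) * x ^ j
    stirling-orthogonality (suc p) (suc i) = begin
      stirlingTransform (suc p) (b (suc i))
        ≈⟨ stirlingTransform-suc p (b (suc i)) ⟩
      stirlingTransform p (λ j → b (suc i) (suc j)) - fromℕ p * x * stirlingTransform p (b (suc i))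
        ≈⟨ +-congʳ (trans (stirlingTransform-cong p (λ j _ → b-suc j)) (stirlingTransform-+ p _ _)) ⟩
      stirlingTransform p (λ j → fromℕ (suc i) * x * b (suc i) j) + stirlingTransform p (b i)
        - fromℕ p * x * stirlingTransform p (b (suc i))
        ≈⟨ +-cong (+-cong (trans (stirlingTransform-*ˡ p _ _) (*-congˡ (stirling-orthogonality p (suc i))))
                          (stirling-orthogonality p i))
                  (-‿cong (*-congˡ (stirling-orthogonality p (suc i)))) ⟩
      fromℕ (suc i) * x * δ p (suc i) + δ p i - fromℕ p * x * δ p (suc i)
        ≈⟨ +-congˡ (-‿cong (sym (δ-scale p (suc i) x))) ⟩
      fromℕ (suc i) * x * δ p (suc i) + δ p i - fromℕ (suc i) * x * δ p (suc i)
        ≈⟨ solve 2 (λ u e → u :+ e :- u := e) refl _ (δ p i) ⟩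
      δ p i ∎
      where
      b : ℕ → ℕ → Carrier
      b i j = fromℕ (stirling₂ j i) * x ^ (j ∸ i)
      b-suc : ∀ j → b (suc i) (suc j) ≈ fromℕ (suc i) * x * b (suc i) j + b i j
      b-suc j = begin
        fromℕ (stirling₂ (suc j) (suc i)) * x ^ (j ∸ i)
          ≈⟨ trans (*-congʳ (fromℕ-stirling₂-suc j i)) (distribʳ _ _ _) ⟩
        fromℕ (suc i) * fromℕ (stirling₂ j (suc i)) * x ^ (j ∸ i) + b i j
          ≈⟨ +-congʳ (trans (*-assoc _ _ _) (*-congˡ (*-^-∸-suc x j i (λ j≤i → fromℕ-stirling₂-vanishes (s≤s j≤i))))) ⟩
        fromℕ (suc i) * (x * b (suc i) j) + b i j
          ≈⟨ +-congʳ (sym (*-assoc _ _ _)) ⟩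
        fromℕ (suc i) * x * b (suc i) j + b i j ∎

    stirling-inversion : ∀ p (w : ℕ → Carrier) →
      stirlingTransform p (λ j → sumTo j (λ i → w i * (fromℕ (stirling₂ j i) * x ^ (j ∸ i)))) ≈ w p
    stirling-inversion p w = begin
      stirlingTransform p (λ j → sumTo j (h j))
        ≈⟨ stirlingTransform-cong p (λ j j≤p → sym (sumTo-truncate (h j) j≤p (λ i j<i → h-vanishes j<i))) ⟩
      stirlingTransform p (λ j → sumTo p (h j))
        ≈⟨ stirlingTransform-sumTo p p h ⟩
      sumTo p (λ i → stirlingTransform p (λ j → h j i))
        ≈⟨ sumTo-cong p (λ i _ → trans (stirlingTransform-*ˡ p (w i) _) (*-congˡ (stirling-orthogonality p i))) ⟩
      sumTo p (λ i → w i * δ p i)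
        ≈⟨ δ-sift p w ⟩
      w p ∎
      where
      h : ℕ → ℕ → Carrier
      h j i = w i * (fromℕ (stirling₂ j i) * x ^ (j ∸ i))
      h-vanishes : ∀ {j i} → j < i → h j i ≈ 0#
      h-vanishes j<i = trans (*-congˡ (trans (*-congʳ (fromℕ-stirling₂-vanishes j<i)) (zeroˡ _))) (zeroʳ _)

  module _ (char0 : CharZero) (k : ℕ) (a q la : Carrier) (L : Fin k → Carrier)
           (L≉0 : ∀ i → ¬ L i ≈ 0#) (a+j≉0 : ∀ j → ¬ a + fromℕ j ≈ 0#) where
    open PolyBernoulli F k a q la L

    -- H n p m unfolds to prefactor p m * stirlingTransform (- q) p (λ i → B (n ℕ.+ i) m).
    prefactor : ℕ → ℕ → Carrier
    prefactor p m = (fromℕ (p !) * l ^ p) ⁻¹ * ((fromℕ p + a + fromℕ m) / (a + fromℕ m)) ^ k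

    a+m+i≉0 : ∀ m i → ¬ a + fromℕ m + fromℕ i ≈ 0#
    a+m+i≉0 m i = ≉0-resp-≈ (trans (+-congˡ (fromℕ-homo-+ m i)) (sym (+-assoc _ _ _))) (a+j≉0 (m ℕ.+ i))

    p!lᵖ≉0 : ∀ p → ¬ fromℕ (p !) * l ^ p ≈ 0#
    p!lᵖ≉0 p = *-≉0 (fromℕ-!-≉0 char0 p) (^-≉0 p (prod-≉0 k L L≉0))

    prefactor-suc : ∀ p m → l * fromℕ (suc p) * (fromℕ p + a + fromℕ m) ^ k
                              / (fromℕ p + a + fromℕ m + 1#) ^ k * prefactor (suc p) m ≈ prefactor p m
    prefactor-suc p m = begin
      u * P ^ k * R ⁻¹ * ((fromℕ (suc p !) * l ^ suc p) ⁻¹ * (Q / c) ^ k)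
        ≈⟨ *-congˡ (*-cong (trans (⁻¹-cong G≈uFp) (⁻¹-distrib-* u≉0 (p!lᵖ≉0 p)))
                           (trans (^-distrib-* Q (c ⁻¹) k) (*-congʳ Qᵏ≈R))) ⟩
      u * P ^ k * R ⁻¹ * (u ⁻¹ * Fp ⁻¹ * (R * (c ⁻¹) ^ k))
        ≈⟨ solve 7 (λ u Pk R′ u′ F′ R C → u :* Pk :* R′ :* (u′ :* F′ :* (R :* C))
                                        := u :* u′ :* (R :* R′) :* (F′ :* (Pk :* C)))
                   refl u (P ^ k) (R ⁻¹) (u ⁻¹) (Fp ⁻¹) R ((c ⁻¹) ^ k) ⟩
      u * u ⁻¹ * (R * R ⁻¹) * (Fp ⁻¹ * (P ^ k * (c ⁻¹) ^ k))
        ≈⟨ *-cong (trans (*-cong (⁻¹-inverse u u≉0) (⁻¹-inverse R R≉0)) (*-identityˡ 1#))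
                  (*-congˡ (sym (^-distrib-* P (c ⁻¹) k))) ⟩
      1# * prefactor p m
        ≈⟨ *-identityˡ _ ⟩
      prefactor p m ∎
      where
      c P Q R u Fp : Carrier
      c = a + fromℕ m
      P = fromℕ p + a + fromℕ m
      Q = fromℕ (suc p) + a + fromℕ m
      R = (P + 1#) ^ k
      u = l * fromℕ (suc p)
      Fp = fromℕ (p !) * l ^ p
      u≉0 : ¬ u ≈ 0#
      u≉0 = *-≉0 (prod-≉0 k L L≉0) (char0 p)
      G≈uFp : fromℕ (suc p !) * l ^ suc p ≈ u * Fp
      G≈uFp = trans (*-congʳ (fromℕ-homo-* (suc p) (p !)))
        (solve 4 (λ s f l lᵖ → s :* f :* (l :* lᵖ) := l :* s :* (f :* lᵖ)) refl (fromℕ (suc p)) (fromℕ (p !)) l (l ^ p))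
      Qᵏ≈R : Q ^ k ≈ R
      Qᵏ≈R = ^-congˡ k (solve 4 (λ o p a m → o :+ p :+ a :+ m := p :+ a :+ m :+ o) refl 1# (fromℕ p) a (fromℕ m))
      R≉0 : ¬ R ≈ 0#
      R≉0 = ^-≉0 k (≉0-resp-≈ (solve 4 (λ o p a m → a :+ m :+ (o :+ p) := p :+ a :+ m :+ o) refl 1# (fromℕ p) a (fromℕ m))
                               (a+m+i≉0 m (suc p)))

    stirlingTransform-B-suc : ∀ n p m →
      stirlingTransform (- q) (suc p) (λ i → B (n ℕ.+ i) m) ≈
      stirlingTransform (- q) p (λ i → B (suc n ℕ.+ i) m) + fromℕ p * q * stirlingTransform (- q) p (λ i → B (n ℕ.+ i) m)
    stirlingTransform-B-suc n p m = begin
      stirlingTransform (- q) (suc p) (λ i → B (n ℕ.+ i) m)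
        ≈⟨ stirlingTransform-suc (- q) p _ ⟩
      stirlingTransform (- q) p (λ i → B (n ℕ.+ suc i) m) - fromℕ p * - q * D
        ≈⟨ +-cong (stirlingTransform-cong (- q) p (λ i _ → reflexive (≡.cong (λ j → B j m) (ℕP.+-suc n i))))
                  (solve 3 (λ P q D → :- (P :* :- q :* D) := P :* q :* D) refl (fromℕ p) q D) ⟩
      stirlingTransform (- q) p (λ i → B (suc n ℕ.+ i) m) + fromℕ p * q * D ∎
      where
      D : Carrier
      D = stirlingTransform (- q) p (λ i → B (n ℕ.+ i) m)

    H-suc : ∀ n p m → H (suc n) p m ≈
         l * fromℕ (suc p) * (fromℕ p + a + fromℕ m) ^ k
           / (fromℕ p + a + fromℕ m + 1#) ^ k * H n (suc p) m
         - fromℕ p * q * H n p m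
    H-suc n p m = sym (begin
      coefficient * (prefactor (suc p) m * D (suc p)) - fromℕ p * q * (prefactor p m * D p)
        ≈⟨ +-congʳ (trans (sym (*-assoc _ _ _)) (*-cong (prefactor-suc p m) (stirlingTransform-B-suc n p m))) ⟩
      prefactor p m * (D′ + fromℕ p * q * D p) - fromℕ p * q * (prefactor p m * D p)
        ≈⟨ solve 5 (λ A D′ P q D → A :* (D′ :+ P :* q :* D) :- P :* q :* (A :* D) := A :* D′) refl _ D′ _ q _ ⟩
      prefactor p m * D′ ∎)
      where
      coefficient D′ : Carrier
      coefficient = l * fromℕ (suc p) * (fromℕ p + a + fromℕ m) ^ k / (fromℕ p + a + fromℕ m + 1#) ^ k
      D′ = stirlingTransform (- q) p (λ i → B (suc n ℕ.+ i) m)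
      D : ℕ → Carrier
      D p = stirlingTransform (- q) p (λ i → B (n ℕ.+ i) m)

    weight : ℕ → ℕ → Carrier
    weight m i = fromℕ (i !) * (la * l ^ i) / (a + fromℕ m + fromℕ i) ^ k

    B-stirling₂ : ∀ j m → B j m ≈
      (a + fromℕ m) ^ k / a ^ k * sumTo j (λ i → weight m i * (fromℕ (stirling₂ j i) * (- q) ^ (j ∸ i)))
    B-stirling₂ j m = *-congˡ (sumTo-cong j (λ i _ →
      solve 5 (λ f X L C S → f :* X :* L :* C :* S := f :* L :* C :* (S :* X)) refl _ _ _ _ _))

    H-zero : ∀ p m → H 0 p m ≈ la / a ^ k
    H-zero p m = begin
      prefactor p m * stirlingTransform (- q) p (λ j → B j m)
        ≈⟨ *-congˡ (trans (stirlingTransform-cong (- q) p (λ j _ → B-stirling₂ j m))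
                   (trans (stirlingTransform-*ˡ (- q) p _ _) (*-congˡ (stirling-inversion (- q) p (weight m))))) ⟩
      Fp ⁻¹ * (P / c) ^ k * (c ^ k * (a ^ k) ⁻¹ * (fromℕ (p !) * (la * l ^ p) * Cp ⁻¹))
        ≈⟨ solve 8 (λ F′ Pc cᵏ A′ f la lᵖ C′ → F′ :* Pc :* (cᵏ :* A′ :* (f :* (la :* lᵖ) :* C′))
                                            := f :* lᵖ :* F′ :* (Pc :* cᵏ :* C′) :* (la :* A′))
                   refl (Fp ⁻¹) ((P / c) ^ k) (c ^ k) ((a ^ k) ⁻¹) (fromℕ (p !)) la (l ^ p) (Cp ⁻¹) ⟩
      Fp * Fp ⁻¹ * ((P / c) ^ k * c ^ k * Cp ⁻¹) * (la / a ^ k)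
        ≈⟨ *-congʳ (*-cong (⁻¹-inverse Fp (p!lᵖ≉0 p)) (*-congʳ (trans (sym (^-distrib-* (P / c) c k)) (^-congˡ k P/c*c≈c+p)))) ⟩
      1# * (Cp * Cp ⁻¹) * (la / a ^ k)
        ≈⟨ *-congʳ (trans (*-identityˡ _) (⁻¹-inverse Cp (^-≉0 k (a+m+i≉0 m p)))) ⟩
      1# * (la / a ^ k)
        ≈⟨ *-identityˡ _ ⟩
      la / a ^ k ∎
      where
      c P Fp Cp : Carrier
      c = a + fromℕ m
      P = fromℕ p + a + fromℕ m
      Fp = fromℕ (p !) * l ^ p
      Cp = (c + fromℕ p) ^ k
      P/c*c≈c+p : P / c * c ≈ c + fromℕ p
      P/c*c≈c+p = trans (/-*-cancel P (a+j≉0 m)) (solve 3 (λ p a m → p :+ a :+ m := a :+ m :+ p) refl (fromℕ p) a (fromℕ m))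

theorem7 : ∀ {c ℓ} (F : Field c ℓ) → let open Field F in
    CharZero →
    (k : ℕ) → NonZero k →
    (a q la : Carrier) → (L : Fin k → Carrier) →
    ¬ (a ≈ 0#) → ¬ (q ≈ 0#) → (∀ i → ¬ (L i ≈ 0#)) →
    (∀ j → ¬ (a + fromℕ j ≈ 0#)) →
    let open PolyBernoulli F k a q la L in
    (∀ n p m → H (suc n) p m ≈
         l * fromℕ (suc p) * (fromℕ p + a + fromℕ m) ^ k
           / (fromℕ p + a + fromℕ m + 1#) ^ k * H n (suc p) m
         - fromℕ p * q * H n p m)
    × (∀ p m → H 0 p m ≈ la / a ^ k)
theorem7 F char0 k _ a q la L _ _ L≉0 a+j≉0 =
  H-suc F char0 k a q la L L≉0 a+j≉0 , H-zero F char0 k a q la L L≉0 a+j≉0
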